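{- For every integer $m\ge 24$ with $m\notin\{25,26,28,29,31,32,34,35,37,38,40,41,42,43,44,46,47,49,50,52,53,55,56,58,59,61,62,73,74,77,79,82,83,85,86\}$, there exists a $3$-way $(v,9,2)$ Steiner trade of volume $m$ (for some $v$).
   Context: For integers $k>t\ge1$, a $3$-way $(v,k,t)$ trade of volume $m$ consists of three pairwise disjoint collections $T_1,T_2,T_3$, each of $m$ blocks ($k$-subsets of a $v$-set $V$), such that every $t$-subset of $V$ is contained in the same number of blocks in each $T_i$. Its foundation $\mathrm{found}(T)$ is the set of points covered by the blocks. It is a Steiner trade if every $t$-subset of $\mathrm{found}(T)$ occurs in at most one block of each $T_i$. -}

module Defs where

open import Data.Nat using (ℕ; _≤_)
open import Data.Fin.Subset using (Subset; _⊆_; ∣_∣; ⋃)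
open import Data.Fin.Subset.Properties using (_⊆?_)
open import Data.List using (List; length; filter; _++_)
open import Data.List.Membership.Propositional using (_∈_; _∉_)
open import Data.Product using (_×_)
open import Relation.Binary.PropositionalEquality using (_≡_)

-- a block collection on the point set Fin v is a list of subsets of Fin v
-- (a list, so that repeated blocks are allowed, i.e. a multiset)

occ : ∀ {v} → Subset v → List (Subset v) → ℕ
occ S T = length (filter (S ⊆?_) T)

AllKSubsets : ∀ {v} → ℕ → List (Subset v) → Set
AllKSubsets k T = ∀ B → B ∈ T → ∣ B ∣ ≡ k

DisjointColl : ∀ {v} → List (Subset v) → List (Subset v) → Set
DisjointColl T U = ∀ B → B ∈ T → B ∉ U

record ThreeWayTrade (v k t m : ℕ) : Set where
  field
    T₁ T₂ T₃ : List (Subset v)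
    vol₁ : length T₁ ≡ m
    vol₂ : length T₂ ≡ m
    vol₃ : length T₃ ≡ m
    blocks₁ : AllKSubsets k T₁
    blocks₂ : AllKSubsets k T₂
    blocks₃ : AllKSubsets k T₃
    disj₁₂ : DisjointColl T₁ T₂
    disj₁₃ : DisjointColl T₁ T₃
    disj₂₃ : DisjointColl T₂ T₃
    bal₁₂ : ∀ (S : Subset v) → ∣ S ∣ ≡ t → occ S T₁ ≡ occ S T₂
    bal₁₃ : ∀ (S : Subset v) → ∣ S ∣ ≡ t → occ S T₁ ≡ occ S T₃

  found : Subset v
  found = ⋃ (T₁ ++ T₂ ++ T₃)

IsSteiner : ∀ {v k t m} → ThreeWayTrade v k t m → Set
IsSteiner {v} {k} {t} T =
  ∀ (S : Subset v) → ∣ S ∣ ≡ t → S ⊆ found →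
    (occ S T₁ ≤ 1) × (occ S T₂ ≤ 1) × (occ S T₃ ≤ 1)
  where open ThreeWayTrade T

excluded : List ℕ
excluded = 25 ∷ 26 ∷ 28 ∷ 29 ∷ 31 ∷ 32 ∷ 34 ∷ 35 ∷ 37 ∷ 38 ∷ 40 ∷ 41 ∷ 42 ∷ 43 ∷ 44 ∷ 46 ∷ 47 ∷ 49 ∷ 50 ∷ 52 ∷ 53 ∷ 55 ∷ 56 ∷ 58 ∷ 59 ∷ 61 ∷ 62 ∷ 73 ∷ 74 ∷ 77 ∷ 79 ∷ 82 ∷ 83 ∷ 85 ∷ 86 ∷ []
  where open Data.List using (_∷_; [])

module Submission where

open import Defs
open import Data.Nat using (ℕ; zero; suc; _+_; _*_; _∸_; _≤_; _<_; z≤n; s≤s; s≤s⁻¹; NonZero; _≡ᵇ_; _<ᵇ_; _%_; _/_; _≟_; _<?_)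
open import Data.Nat.Properties
  using (suc-injective; +-assoc; +-identityʳ; ≤-refl; ≤-trans; n≤1+n; <-cmp; <⇒≱; ≮⇒≥; ≡ᵇ⇒≡; <ᵇ⇒<; *-cancelˡ-≤; m≤n⇒∃[o]m+o≡n)
open import Data.Nat.Tactic.RingSolver using (solve-∀)
open import Data.Bool using (Bool; true; false; _∧_; _∨_; _xor_; if_then_else_; T)
open import Data.Bool.Properties using (∧-comm)
open import Data.Fin using (Fin; zero; suc; toℕ; fromℕ<; _↑ˡ_; _↑ʳ_)
open import Data.Fin.Properties using (toℕ-injective; toℕ-fromℕ<; toℕ<n) renaming (suc-injective to Fin-suc-injective)
open import Data.Fin.Subset using (Subset; _⊆_; ∣_∣) renaming (_∈_ to _∈ₛ_; _∉_ to _∉ₛ_; ⊥ to ∅)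
open import Data.Fin.Subset.Properties using (_⊆?_; ∣⊥∣≡0)
open import Data.Vec using ([]; _∷_; here; there; lookup; tabulate; _++_)
open import Data.Vec.Properties using (lookup∘tabulate; lookup-++ˡ; lookup-++ʳ; lookup-replicate; ++-injectiveˡ; ++-injectiveʳ; []=⇒lookup; lookup⇒[]=)
open import Data.List using (List; []; _∷_; length; filter; map; applyDownFrom) renaming (_++_ to _++ᴸ_)
open import Data.List.Properties using (length-++; length-map; length-applyDownFrom)
open import Data.List.Membership.Propositional using (_∉_) renaming (_∈_ to _∈ᴸ_)
open import Data.List.Membership.Propositional.Properties using (∈-++⁻; ∈-map⁻; ∈-applyDownFrom⁻)
open import Data.List.Membership.DecPropositional _≟_ using (_∈?_)
open import Data.Product using (Σ; ∃-syntax; ∃₂; _×_; _,_; proj₁; proj₂)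
open import Data.Sum using (_⊎_; inj₁; inj₂) renaming (map to ⊎-map)
open import Data.Empty using (⊥-elim)
open import Data.Unit using (tt)
open import Relation.Nullary using (Dec; yes; no; does)
open import Relation.Unary using (Decidable)
open import Relation.Binary.Definitions using (tri<; tri≈; tri>)
open import Relation.Binary.PropositionalEquality using (_≡_; _≢_; refl; sym; trans; cong; cong₂; subst)

-- For t = 2 the balance and Steiner conditions only concern
-- pairs of distinct points, so we work with pair trades: three pairwise
-- disjoint collections of k-sets covering each pair of distinct points equally
-- often, and at most once.  A pair trade is a 3-way (v,k,2) Steiner trade
-- (pairTrade⇒steinerTrade), and pair trades on disjoint point sets can be
-- juxtaposed, adding their volumes (DisjointUnion).  Base trades with k = 9
-- come from S parallel classes of 8-sets on N points, any two points together
-- at most once: the i-th collection enlarges every block of class c by a new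
-- point ∞ indexed by c + i mod S (CyclicExtension).  The classes used (lines
-- of AG(2,8); three shifted classes on ℤ_M × 8 groups) are certified by
-- evaluating boolean checks whose soundness is proved once, giving volumes
-- 24, 32, 40 and 27, 30, …, 45.  Juxtaposition then reaches every 3q ≥ 24,
-- and adding 40 or 32 every admissible m ≢ 0 (mod 3).

-- Boolean facts read back as propositions (the certificates below are
-- booleans proved equal to true by evaluation).
toT : ∀ {b} → b ≡ true → T b
toT refl = tt

∧-true : ∀ {a b} → a ∧ b ≡ true → a ≡ true × b ≡ true
∧-true {true} e = refl , e

∨-true : ∀ {a b} → a ∨ b ≡ true → a ≡ true ⊎ b ≡ true
∨-true {true}  e = inj₁ e
∨-true {false} e = inj₂ e

xor-true⇒≢ : ∀ {a b} → a xor b ≡ true → a ≢ b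
xor-true⇒≢ {true}  () refl
xor-true⇒≢ {false} () refl

ind : Bool → ℕ
ind true  = 1
ind false = 0

sumBelow : ℕ → (ℕ → ℕ) → ℕ
sumBelow zero    f = 0
sumBelow (suc n) f = f n + sumBelow n f

allBelow : ℕ → (ℕ → Bool) → Bool
allBelow zero    f = true
allBelow (suc n) f = f n ∧ allBelow n f

anyBelow : ℕ → (ℕ → Bool) → Bool
anyBelow zero    f = false
anyBelow (suc n) f = f n ∨ anyBelow n f

allBelow-sound : ∀ {n f} → allBelow n f ≡ true → ∀ {k} → k < n → f k ≡ true
allBelow-sound {suc n} {f} ok {k} k<1+n with <-cmp k n | ∧-true {f n} ok
... | tri< k<n _ _ | _ , rest = allBelow-sound rest k<n
... | tri≈ _ refl _ | fn , _ = fn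
... | tri> _ _ n<k | _ = ⊥-elim (<⇒≱ k<1+n n<k)

anyBelow-sound : ∀ {n f} → anyBelow n f ≡ true → ∃[ k ] (k < n × f k ≡ true)
anyBelow-sound {suc n} {f} ok with ∨-true {f n} ok
... | inj₁ fn = n , ≤-refl , fn
... | inj₂ rest with anyBelow-sound rest
...   | k , k<n , fk = k , ≤-trans k<n (n≤1+n n) , fk

sumBelow-cong : ∀ n {f g : ℕ → ℕ} → (∀ k → f k ≡ g k) → sumBelow n f ≡ sumBelow n g
sumBelow-cong zero    f≗g = refl
sumBelow-cong (suc n) f≗g = cong₂ _+_ (f≗g n) (sumBelow-cong n f≗g)

sumBelow-suc : ∀ n f → sumBelow (suc n) f ≡ f 0 + sumBelow n (λ k → f (suc k))
sumBelow-suc zero    f = refl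
sumBelow-suc (suc n) f = trans (cong (f (suc n) +_) (sumBelow-suc n f)) (+-exchange (f (suc n)) (f 0) _)
  where
  +-exchange : ∀ a b c → a + (b + c) ≡ b + (a + c)
  +-exchange = solve-∀

count : {A : Set} → (A → Bool) → List A → ℕ
count f []       = 0
count f (x ∷ xs) = ind (f x) + count f xs

count-++ : ∀ {A : Set} (f : A → Bool) xs ys → count f (xs ++ᴸ ys) ≡ count f xs + count f ys
count-++ f []       ys = refl
count-++ f (x ∷ xs) ys = trans (cong (ind (f x) +_) (count-++ f xs ys)) (sym (+-assoc (ind (f x)) _ _))

count-map : ∀ {A B : Set} (f : B → Bool) (g : A → B) xs → count f (map g xs) ≡ count (λ x → f (g x)) xs
count-map f g []       = refl
count-map f g (x ∷ xs) = cong (ind (f (g x)) +_) (count-map f g xs)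

count-cong : ∀ {A : Set} {f g : A → Bool} xs → (∀ x → f x ≡ g x) → count f xs ≡ count g xs
count-cong []       f≗g = refl
count-cong (x ∷ xs) f≗g = cong₂ _+_ (cong ind (f≗g x)) (count-cong xs f≗g)

count-none : ∀ {A : Set} {f : A → Bool} xs → (∀ x → f x ≡ false) → count f xs ≡ 0
count-none []       none = refl
count-none (x ∷ xs) none rewrite none x = count-none xs none

length-filter≡count : ∀ {A : Set} {P : A → Set} (P? : Decidable P) xs →
                      length (filter P? xs) ≡ count (λ x → does (P? x)) xs
length-filter≡count P? []       = refl
length-filter≡count P? (x ∷ xs) with does (P? x)
... | true  = cong suc (length-filter≡count P? xs)
... | false = length-filter≡count P? xs

grid : {A : Set} → ℕ → ℕ → (ℕ → ℕ → A) → List A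
grid zero    M f = []
grid (suc S) M f = applyDownFrom (f S) M ++ᴸ grid S M f

length-grid : ∀ {A : Set} S M (f : ℕ → ℕ → A) → length (grid S M f) ≡ S * M
length-grid zero    M f = refl
length-grid (suc S) M f =
  trans (length-++ (applyDownFrom (f S) M)) (cong₂ _+_ (length-applyDownFrom (f S) M) (length-grid S M f))

∈-grid⁻ : ∀ {A : Set} {x : A} S M f → x ∈ᴸ grid S M f → ∃₂ λ c y → c < S × y < M × x ≡ f c y
∈-grid⁻ (suc S) M f x∈ with ∈-++⁻ (applyDownFrom (f S) M) x∈
... | inj₁ x∈row with ∈-applyDownFrom⁻ (f S) x∈row
...   | y , y<M , refl = S , y , ≤-refl , y<M , refl
∈-grid⁻ (suc S) M f x∈ | inj₂ x∈rest with ∈-grid⁻ S M f x∈rest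
...   | c , y , c<S , y<M , refl = c , y , ≤-trans c<S (n≤1+n S) , y<M , refl

count-grid : ∀ {A : Set} (g : A → Bool) S M f →
             count g (grid S M f) ≡ sumBelow S (λ c → sumBelow M (λ y → ind (g (f c y))))
count-grid g zero    M f = refl
count-grid g (suc S) M f =
  trans (count-++ g (applyDownFrom (f S) M) (grid S M f)) (cong₂ _+_ (row M) (count-grid g S M f))
  where
  row : ∀ n → count g (applyDownFrom (f S) n) ≡ sumBelow n (λ y → ind (g (f S y)))
  row zero    = refl
  row (suc n) = cong (ind (g (f S n)) +_) (row n)

card-tabulate : ∀ n (f : ℕ → Bool) → ∣ tabulate {n = n} (λ p → f (toℕ p)) ∣ ≡ sumBelow n (λ k → ind (f k))
card-tabulate zero    f = refl
card-tabulate (suc n) f =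
  trans (card-∷ (f 0)) (sym (sumBelow-suc n (λ k → ind (f k))))
  where
  card-∷ : ∀ b → ∣ b ∷ tabulate {n = n} (λ p → f (suc (toℕ p))) ∣ ≡ ind b + sumBelow n (λ k → ind (f (suc k)))
  card-∷ true  = cong suc (card-tabulate n (λ k → f (suc k)))
  card-∷ false = card-tabulate n (λ k → f (suc k))

card-++ : ∀ {a b} (xs : Subset a) (ys : Subset b) → ∣ xs ++ ys ∣ ≡ ∣ xs ∣ + ∣ ys ∣
card-++ []           ys = refl
card-++ (true  ∷ xs) ys = cong suc (card-++ xs ys)
card-++ (false ∷ xs) ys = card-++ xs ys

size0-empty : ∀ {n} (S : Subset n) → ∣ S ∣ ≡ 0 → ∀ {x} → x ∉ₛ S
size0-empty (false ∷ S) e (there x∈S) = size0-empty S e x∈S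

size1-singleton : ∀ {n} (S : Subset n) → ∣ S ∣ ≡ 1 → ∃[ q ] (q ∈ₛ S × ∀ {x} → x ∈ₛ S → x ≡ q)
size1-singleton (true ∷ S) e =
  zero , here , λ { {zero} here → refl ; {suc x} (there x∈S) → ⊥-elim (size0-empty S (suc-injective e) x∈S) }
size1-singleton (false ∷ S) e with size1-singleton S e
... | q , q∈S , unique = suc q , there q∈S , λ { {suc x} (there x∈S) → cong suc (unique x∈S) }

record IsPair {n} (S : Subset n) : Set where
  field
    p q    : Fin n
    p≢q    : p ≢ q
    p∈S    : p ∈ₛ S
    q∈S    : q ∈ₛ S
    within : ∀ {x} → x ∈ₛ S → x ≡ p ⊎ x ≡ q

size2-pair : ∀ {n} (S : Subset n) → ∣ S ∣ ≡ 2 → IsPair S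
size2-pair (true ∷ S) e with size1-singleton S (suc-injective e)
... | q , q∈S , unique = record
  { p = zero ; q = suc q ; p≢q = λ () ; p∈S = here ; q∈S = there q∈S
  ; within = λ { {zero} here → inj₁ refl ; {suc x} (there x∈S) → inj₂ (cong suc (unique x∈S)) } }
size2-pair (false ∷ S) e = record
  { p = suc p ; q = suc q ; p≢q = λ p≡q → p≢q (Fin-suc-injective p≡q)
  ; p∈S = there p∈S ; q∈S = there q∈S
  ; within = λ { {suc x} (there x∈S) → ⊎-map (cong suc) (cong suc) (within x∈S) } }
  where open IsPair (size2-pair S e)

pairCount : ∀ {v} → Fin v → Fin v → List (Subset v) → ℕ
pairCount p q = count (λ B → lookup B p ∧ lookup B q)

pairCount-sym : ∀ {v} (p q : Fin v) T → pairCount p q T ≡ pairCount q p T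
pairCount-sym p q T = count-cong T (λ B → ∧-comm (lookup B p) (lookup B q))

does-sound : ∀ {P : Set} (P? : Dec P) → does P? ≡ true → P
does-sound (yes x) _ = x

does≡ : ∀ {P : Set} (P? : Dec P) b → (P → b ≡ true) → (b ≡ true → P) → does P? ≡ b
does≡ (yes x) b to from = sym (to x)
does≡ (no ¬x) true  to from = ⊥-elim (¬x (from refl))
does≡ (no ¬x) false to from = refl

occ≡pairCount : ∀ {v} {S : Subset v} (pair : IsPair S) T → occ S T ≡ pairCount (IsPair.p pair) (IsPair.q pair) T
occ≡pairCount {S = S} pair T = trans (length-filter≡count (S ⊆?_) T) (count-cong T contains-pair)
  where
  open IsPair pair
  contains-pair : ∀ B → does (S ⊆? B) ≡ (lookup B p ∧ lookup B q)
  contains-pair B = does≡ (S ⊆? B) _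
    (λ S⊆B → cong₂ _∧_ ([]=⇒lookup (S⊆B p∈S)) ([]=⇒lookup (S⊆B q∈S)))
    (λ both x∈S → in-B both (within x∈S))
    where
    in-B : ∀ {x} → (lookup B p ∧ lookup B q) ≡ true → x ≡ p ⊎ x ≡ q → x ∈ₛ B
    in-B both (inj₁ refl) = lookup⇒[]= p B (proj₁ (∧-true both))
    in-B both (inj₂ refl) = lookup⇒[]= q B (proj₂ (∧-true {lookup B p} both))

record PairTrade (v k m : ℕ) : Set where
  field
    T₁ T₂ T₃ : List (Subset v)
    vol₁ : length T₁ ≡ m
    vol₂ : length T₂ ≡ m
    vol₃ : length T₃ ≡ m
    blocks₁ : AllKSubsets k T₁
    blocks₂ : AllKSubsets k T₂
    blocks₃ : AllKSubsets k T₃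
    disj₁₂ : DisjointColl T₁ T₂
    disj₁₃ : DisjointColl T₁ T₃
    disj₂₃ : DisjointColl T₂ T₃
    pairs₁₂ : ∀ p q → p ≢ q → pairCount p q T₁ ≡ pairCount p q T₂
    pairs₁₃ : ∀ p q → p ≢ q → pairCount p q T₁ ≡ pairCount p q T₃
    steiner : ∀ p q → p ≢ q → pairCount p q T₁ ≤ 1

pairTrade⇒steinerTrade : ∀ {v k m} → PairTrade v k m → Σ (ThreeWayTrade v k 2 m) IsSteiner
pairTrade⇒steinerTrade {v} {k} {m} P = trade , steinerTrade
  where
  open PairTrade P
  balanced : ∀ {U} → (∀ p q → p ≢ q → pairCount p q T₁ ≡ pairCount p q U) →
             ∀ (S : Subset v) → ∣ S ∣ ≡ 2 → occ S T₁ ≡ occ S U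
  balanced {U} same S ∣S∣≡2 = trans (occ≡pairCount pair T₁) (trans (same p q p≢q) (sym (occ≡pairCount pair U)))
    where
    pair : IsPair S
    pair = size2-pair S ∣S∣≡2
    open IsPair pair
  trade : ThreeWayTrade v k 2 m
  trade = record { T₁ = T₁ ; T₂ = T₂ ; T₃ = T₃ ; vol₁ = vol₁ ; vol₂ = vol₂ ; vol₃ = vol₃
                 ; blocks₁ = blocks₁ ; blocks₂ = blocks₂ ; blocks₃ = blocks₃
                 ; disj₁₂ = disj₁₂ ; disj₁₃ = disj₁₃ ; disj₂₃ = disj₂₃
                 ; bal₁₂ = balanced {T₂} pairs₁₂ ; bal₁₃ = balanced {T₃} pairs₁₃ }
  steinerTrade : IsSteiner trade
  steinerTrade S ∣S∣≡2 _ =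
    at-most-once {T₁} (λ _ _ _ → refl) , at-most-once {T₂} pairs₁₂ , at-most-once {T₃} pairs₁₃
    where
    pair : IsPair S
    pair = size2-pair S ∣S∣≡2
    open IsPair pair
    at-most-once : ∀ {U} → (∀ p q → p ≢ q → pairCount p q T₁ ≡ pairCount p q U) → occ S U ≤ 1
    at-most-once {U} same = subst (_≤ 1) (trans (same p q p≢q) (sym (occ≡pairCount pair U))) (steiner p q p≢q)

data Side (v w : ℕ) : Fin (v + w) → Set where
  left  : (i : Fin v) → Side v w (i ↑ˡ w)
  right : (j : Fin w) → Side v w (v ↑ʳ j)

side : ∀ v w (p : Fin (v + w)) → Side v w p
side zero    w p       = right p
side (suc v) w zero    = left zero
side (suc v) w (suc p) with side v w p
... | left i  = left (suc i)
... | right j = right j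

pairCount-map : ∀ {n n'} (f : Subset n → Subset n') A {p q : Fin n'} {p' q' : Fin n} →
                (∀ B → lookup (f B) p ≡ lookup B p') → (∀ B → lookup (f B) q ≡ lookup B q') →
                pairCount p q (map f A) ≡ pairCount p' q' A
pairCount-map f A fp fq = trans (count-map _ f A) (count-cong A (λ B → cong₂ _∧_ (fp B) (fq B)))

pairCount-map-avoidˡ : ∀ {n n'} (f : Subset n → Subset n') A {p q : Fin n'} →
                       (∀ B → lookup (f B) p ≡ false) → pairCount p q (map f A) ≡ 0
pairCount-map-avoidˡ f A fp = trans (count-map _ f A) (count-none A (λ B → cong (_∧ _) (fp B)))

pairCount-map-avoidʳ : ∀ {n n'} (f : Subset n → Subset n') A {p q : Fin n'} →
                       (∀ B → lookup (f B) q ≡ false) → pairCount p q (map f A) ≡ 0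
pairCount-map-avoidʳ f A {p} {q} fq = trans (pairCount-sym p q (map f A)) (pairCount-map-avoidˡ f A fq)

-- Blocks are nonempty (size suc k), so no block of G turns into one of H.
module DisjointUnion {v w k a b : ℕ} (G : PairTrade v (suc k) a) (H : PairTrade w (suc k) b) where
  module G = PairTrade G
  module H = PairTrade H

  ∅ᵛ : Subset v
  ∅ᵛ = ∅
  ∅ʷ : Subset w
  ∅ʷ = ∅

  L : Subset v → Subset (v + w)
  L B = B ++ ∅ʷ
  R : Subset w → Subset (v + w)
  R B = ∅ᵛ ++ B

  _∪_ : List (Subset v) → List (Subset w) → List (Subset (v + w))
  A ∪ A' = map L A ++ᴸ map R A'

  L-left : ∀ B i → lookup (L B) (i ↑ˡ w) ≡ lookup B i
  L-left B i = lookup-++ˡ B ∅ʷ i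
  L-right : ∀ B j → lookup (L B) (v ↑ʳ j) ≡ false
  L-right B j = trans (lookup-++ʳ B ∅ʷ j) (lookup-replicate j false)
  R-left : ∀ B i → lookup (R B) (i ↑ˡ w) ≡ false
  R-left B i = trans (lookup-++ˡ ∅ᵛ B i) (lookup-replicate i false)
  R-right : ∀ B j → lookup (R B) (v ↑ʳ j) ≡ lookup B j
  R-right B j = lookup-++ʳ ∅ᵛ B j

  data UnionPair (p q : Fin (v + w)) : Set where
    inside-left  : ∀ i i' → i ≢ i' → (∀ A A' → pairCount p q (A ∪ A') ≡ pairCount i i' A) → UnionPair p q
    inside-right : ∀ j j' → j ≢ j' → (∀ A A' → pairCount p q (A ∪ A') ≡ pairCount j j' A') → UnionPair p q
    across       : (∀ A A' → pairCount p q (A ∪ A') ≡ 0) → UnionPair p q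

  unionPair : ∀ p q → p ≢ q → UnionPair p q
  unionPair p q p≢q with side v w p | side v w q
  ... | left i  | left i'  = inside-left i i' (λ i≡i' → p≢q (cong (_↑ˡ w) i≡i')) λ A A' →
    trans (count-++ _ (map L A) (map R A'))
          (trans (cong₂ _+_ (pairCount-map L A (λ B → L-left B i) (λ B → L-left B i'))
                            (pairCount-map-avoidˡ R A' (λ B → R-left B i)))
                 (+-identityʳ _))
  ... | left i  | right j  = across λ A A' →
    trans (count-++ _ (map L A) (map R A'))
          (cong₂ _+_ (pairCount-map-avoidʳ L A (λ B → L-right B j)) (pairCount-map-avoidˡ R A' (λ B → R-left B i)))
  ... | right j | left i   = across λ A A' →
    trans (count-++ _ (map L A) (map R A'))
          (cong₂ _+_ (pairCount-map-avoidˡ L A (λ B → L-right B j)) (pairCount-map-avoidʳ R A' (λ B → R-left B i)))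
  ... | right j | right j' = inside-right j j' (λ j≡j' → p≢q (cong (v ↑ʳ_) j≡j')) λ A A' →
    trans (count-++ _ (map L A) (map R A'))
          (cong₂ _+_ (pairCount-map-avoidˡ L A (λ B → L-right B j))
                     (pairCount-map R A' (λ B → R-right B j) (λ B → R-right B j')))

  union-pairs : ∀ A₁ A₂ A₁' A₂' →
                (∀ i i' → i ≢ i' → pairCount i i' A₁ ≡ pairCount i i' A₂) →
                (∀ j j' → j ≢ j' → pairCount j j' A₁' ≡ pairCount j j' A₂') →
                ∀ p q → p ≢ q → pairCount p q (A₁ ∪ A₁') ≡ pairCount p q (A₂ ∪ A₂')
  union-pairs A₁ A₂ A₁' A₂' same same' p q p≢q with unionPair p q p≢q
  ... | inside-left i i' i≢i' f  = trans (f A₁ A₁') (trans (same i i' i≢i') (sym (f A₂ A₂')))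
  ... | inside-right j j' j≢j' f = trans (f A₁ A₁') (trans (same' j j' j≢j') (sym (f A₂ A₂')))
  ... | across f                 = trans (f A₁ A₁') (sym (f A₂ A₂'))

  union-steiner : ∀ p q → p ≢ q → pairCount p q (G.T₁ ∪ H.T₁) ≤ 1
  union-steiner p q p≢q with unionPair p q p≢q
  ... | inside-left i i' i≢i' f  = subst (_≤ 1) (sym (f G.T₁ H.T₁)) (G.steiner i i' i≢i')
  ... | inside-right j j' j≢j' f = subst (_≤ 1) (sym (f G.T₁ H.T₁)) (H.steiner j j' j≢j')
  ... | across f                 = subst (_≤ 1) (sym (f G.T₁ H.T₁)) z≤n

  union-volume : ∀ A A' → length A ≡ a → length A' ≡ b → length (A ∪ A') ≡ a + b
  union-volume A A' refl refl = trans (length-++ (map L A)) (cong₂ _+_ (length-map L A) (length-map R A'))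

  ∈-∪⁻ : ∀ {A A' B} → B ∈ᴸ A ∪ A' → (∃[ B₀ ] (B₀ ∈ᴸ A × B ≡ L B₀)) ⊎ (∃[ B₀ ] (B₀ ∈ᴸ A' × B ≡ R B₀))
  ∈-∪⁻ {A} B∈ with ∈-++⁻ (map L A) B∈
  ... | inj₁ B∈L = inj₁ (∈-map⁻ L B∈L)
  ... | inj₂ B∈R = inj₂ (∈-map⁻ R B∈R)

  ∣L∣ : ∀ B → ∣ L B ∣ ≡ ∣ B ∣
  ∣L∣ B = trans (card-++ B ∅ʷ) (trans (cong (∣ B ∣ +_) (∣⊥∣≡0 w)) (+-identityʳ _))
  ∣R∣ : ∀ B → ∣ R B ∣ ≡ ∣ B ∣
  ∣R∣ B = trans (card-++ ∅ᵛ B) (cong (_+ ∣ B ∣) (∣⊥∣≡0 v))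
  L-injective : ∀ {B B'} → L B ≡ L B' → B ≡ B'
  L-injective {B} {B'} = ++-injectiveˡ B B'
  R-injective : ∀ {B B'} → R B ≡ R B' → B ≡ B'
  R-injective = ++-injectiveʳ ∅ᵛ ∅ᵛ

  union-blocks : ∀ A A' → AllKSubsets (suc k) A → AllKSubsets (suc k) A' → AllKSubsets (suc k) (A ∪ A')
  union-blocks A A' sizes sizes' B B∈ with ∈-∪⁻ {A} {A'} B∈
  ... | inj₁ (B₀ , B₀∈ , refl) = trans (∣L∣ B₀) (sizes B₀ B₀∈)
  ... | inj₂ (B₀ , B₀∈ , refl) = trans (∣R∣ B₀) (sizes' B₀ B₀∈)

  -- a left block is never a right block, since blocks are nonempty
  L≢R : ∀ {B B'} → ∣ B ∣ ≡ suc k → L B ≢ R B'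
  L≢R {B} ∣B∣ L≡R with trans (sym ∣B∣) (trans (cong ∣_∣ (++-injectiveˡ B ∅ᵛ L≡R)) (∣⊥∣≡0 v))
  ... | ()

  union-disjoint : ∀ A₁ A₂ A₁' A₂' → AllKSubsets (suc k) A₁ → AllKSubsets (suc k) A₂ →
                   DisjointColl A₁ A₂ → DisjointColl A₁' A₂' → DisjointColl (A₁ ∪ A₁') (A₂ ∪ A₂')
  union-disjoint A₁ A₂ A₁' A₂' sizes₁ sizes₂ d d' B B∈₁ B∈₂
    with ∈-∪⁻ {A₁} {A₁'} B∈₁ | ∈-∪⁻ {A₂} {A₂'} B∈₂
  ... | inj₁ (B₀ , B₀∈ , refl) | inj₁ (B₁ , B₁∈ , L≡L) = d B₀ B₀∈ (subst (_∈ᴸ A₂) (sym (L-injective L≡L)) B₁∈)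
  ... | inj₁ (B₀ , B₀∈ , refl) | inj₂ (B₁ , B₁∈ , L≡R) = L≢R (sizes₁ B₀ B₀∈) L≡R
  ... | inj₂ (B₀ , B₀∈ , refl) | inj₁ (B₁ , B₁∈ , R≡L) = L≢R (sizes₂ B₁ B₁∈) (sym R≡L)
  ... | inj₂ (B₀ , B₀∈ , refl) | inj₂ (B₁ , B₁∈ , R≡R) = d' B₀ B₀∈ (subst (_∈ᴸ A₂') (sym (R-injective R≡R)) B₁∈)

  union : PairTrade (v + w) (suc k) (a + b)
  union = record
    { T₁ = G.T₁ ∪ H.T₁ ; T₂ = G.T₂ ∪ H.T₂ ; T₃ = G.T₃ ∪ H.T₃
    ; vol₁ = union-volume G.T₁ H.T₁ G.vol₁ H.vol₁
    ; vol₂ = union-volume G.T₂ H.T₂ G.vol₂ H.vol₂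
    ; vol₃ = union-volume G.T₃ H.T₃ G.vol₃ H.vol₃
    ; blocks₁ = union-blocks G.T₁ H.T₁ G.blocks₁ H.blocks₁
    ; blocks₂ = union-blocks G.T₂ H.T₂ G.blocks₂ H.blocks₂
    ; blocks₃ = union-blocks G.T₃ H.T₃ G.blocks₃ H.blocks₃
    ; disj₁₂ = union-disjoint G.T₁ G.T₂ H.T₁ H.T₂ G.blocks₁ G.blocks₂ G.disj₁₂ H.disj₁₂
    ; disj₁₃ = union-disjoint G.T₁ G.T₃ H.T₁ H.T₃ G.blocks₁ G.blocks₃ G.disj₁₃ H.disj₁₃
    ; disj₂₃ = union-disjoint G.T₂ G.T₃ H.T₂ H.T₃ G.blocks₂ G.blocks₃ G.disj₂₃ H.disj₂₃
    ; pairs₁₂ = union-pairs G.T₁ G.T₂ H.T₁ H.T₂ G.pairs₁₂ H.pairs₁₂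
    ; pairs₁₃ = union-pairs G.T₁ G.T₃ H.T₁ H.T₃ G.pairs₁₃ H.pairs₁₃
    ; steiner = union-steiner }

-- S colourings of the points 0,…,N-1 with colours below M; the colour
-- classes of each colouring form one parallel class of blocks
record ParallelClasses : Set where
  field
    points classes colours : ℕ
    colour : ℕ → ℕ → ℕ

-- The i-th collection (i < 3) on the points 0,…,N-1 together with new points
-- ∞_j = N + j (j < S) has the blocks {p < N : colour c p ≡ y} ∪ {∞_(c+i mod S)}.
module CyclicExtension (P : ParallelClasses) where
  open ParallelClasses P renaming (points to N; classes to S; colours to M)

  v : ℕ
  v = N + S

  -- reduction mod S of a number below 2S
  wrap : ℕ → ℕ
  wrap x = if x <ᵇ S then x else x ∸ S

  -- inBlock i c p y: point p lies in block y of class c of collection i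
  -- (written so that evaluation computes the colour of p once per class)
  inBlock : ℕ → ℕ → ℕ → ℕ → Bool
  inBlock i c p = if p <ᵇ N then colour c p ≡ᵇ_ else λ _ → wrap (c + i) ≡ᵇ p ∸ N

  block : ℕ → ℕ → ℕ → Subset v
  block i c y = tabulate (λ p → inBlock i c (toℕ p) y)

  collection : ℕ → List (Subset v)
  collection i = grid S M (block i)

  pairsWithin : (ℕ → Bool) → (ℕ → Bool) → ℕ
  pairsWithin f g = sumBelow M (λ y → ind (f y ∧ g y))

  pairCountℕ : ℕ → ℕ → ℕ → ℕ
  pairCountℕ i p q = sumBelow S (λ c → pairsWithin (inBlock i c p) (inBlock i c q))

  pairCount-collection : ∀ i (p q : Fin v) → pairCount p q (collection i) ≡ pairCountℕ i (toℕ p) (toℕ q)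
  pairCount-collection i p q =
    trans (count-grid _ S M (block i))
          (sumBelow-cong S λ c → sumBelow-cong M λ y →
             cong ind (cong₂ _∧_ (lookup∘tabulate _ p) (lookup∘tabulate _ q)))

  sizesOK-in : ℕ → ℕ → Bool
  sizesOK-in k i = allBelow S λ c → allBelow M λ y → sumBelow v (λ p → ind (inBlock i c p y)) ≡ᵇ k

  sizesOK : ℕ → Bool
  sizesOK k = allBelow 3 (sizesOK-in k)

  agree : ℕ → ℕ → ℕ → Bool
  agree a b c = (a ≡ᵇ b) ∧ (a ≡ᵇ c) ∧ (a <ᵇ 2)

  pairsOK : Bool
  pairsOK = allBelow v λ p → allBelow p λ q → agree (pairCountℕ 0 p q) (pairCountℕ 1 p q) (pairCountℕ 2 p q)

  differ : ℕ → ℕ → ℕ → ℕ → ℕ → ℕ → Bool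
  differ i i' c y c' y' = anyBelow v (λ p → inBlock i c p y xor inBlock i' c' p y')

  distinctOK : Bool
  distinctOK = allBelow S λ c → allBelow M λ y → allBelow S λ c' → allBelow M λ y' →
                 differ 0 1 c y c' y' ∧ differ 0 2 c y c' y' ∧ differ 1 2 c y c' y'

  volume : ∀ i → length (collection i) ≡ S * M
  volume i = length-grid S M (block i)

  size-certificate : ∀ {k i c y} → sizesOK k ≡ true → i < 3 → c < S → y < M →
                     (sumBelow v (λ p → ind (inBlock i c p y)) ≡ᵇ k) ≡ true
  size-certificate {k} ok i<3 c<S y<M = allBelow-sound (allBelow-sound (allBelow-sound {f = sizesOK-in k} ok i<3) c<S) y<M

  sizes : ∀ {k} → sizesOK k ≡ true → ∀ {i} → i < 3 → AllKSubsets k (collection i)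
  sizes {k} ok {i} i<3 B B∈ with ∈-grid⁻ S M (block i) B∈
  ... | c , y , c<S , y<M , refl =
    trans (card-tabulate v (λ p → inBlock i c p y)) (≡ᵇ⇒≡ _ k (toT (size-certificate ok i<3 c<S y<M)))

  agree-sound : ∀ {a b c} → agree a b c ≡ true → a ≡ b × a ≡ c × a ≤ 1
  agree-sound {a} {b} {c} ok with ∧-true {a ≡ᵇ b} ok
  ... | a≡b , rest with ∧-true {a ≡ᵇ c} rest
  ...   | a≡c , a<2 = ≡ᵇ⇒≡ a b (toT a≡b) , ≡ᵇ⇒≡ a c (toT a≡c) , s≤s⁻¹ (<ᵇ⇒< a 2 (toT a<2))

  Agree : Fin v → Fin v → Set
  Agree p q = pairCount p q (collection 0) ≡ pairCount p q (collection 1)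
            × pairCount p q (collection 0) ≡ pairCount p q (collection 2)
            × pairCount p q (collection 0) ≤ 1

  Agree-sym : ∀ {p q} → Agree q p → Agree p q
  Agree-sym {p} {q} (e₁ , e₂ , le) =
    trans (sym (swap 0)) (trans e₁ (swap 1)) , trans (sym (swap 0)) (trans e₂ (swap 2)) , subst (_≤ 1) (swap 0) le
    where
    swap : ∀ i → pairCount q p (collection i) ≡ pairCount p q (collection i)
    swap i = pairCount-sym q p (collection i)

  agree-below : pairsOK ≡ true → ∀ p q → toℕ q < toℕ p → Agree p q
  agree-below ok p q q<p with agree-sound (allBelow-sound (allBelow-sound ok (toℕ<n p)) q<p)
  ... | e₁ , e₂ , le =
    trans (at 0) (trans e₁ (sym (at 1))) , trans (at 0) (trans e₂ (sym (at 2))) , subst (_≤ 1) (sym (at 0)) le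
    where
    at : ∀ i → pairCount p q (collection i) ≡ pairCountℕ i (toℕ p) (toℕ q)
    at i = pairCount-collection i p q

  agree-all : pairsOK ≡ true → ∀ p q → p ≢ q → Agree p q
  agree-all ok p q p≢q with <-cmp (toℕ p) (toℕ q)
  ... | tri< p<q _ _ = Agree-sym (agree-below ok q p p<q)
  ... | tri≈ _ p≡q _ = ⊥-elim (p≢q (toℕ-injective p≡q))
  ... | tri> _ _ q<p = agree-below ok p q q<p

  differ-sound : ∀ {i i' c y c' y'} → differ i i' c y c' y' ≡ true → block i c y ≢ block i' c' y'
  differ-sound {i} {i'} {c} {y} {c'} {y'} ok B≡B' with anyBelow-sound ok
  ... | p , p<v , differs =
    xor-true⇒≢ differs (trans (sym (at i c y)) (trans (cong (λ B → lookup B (fromℕ< p<v)) B≡B') (at i' c' y')))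
    where
    at : ∀ i c y → lookup (block i c y) (fromℕ< p<v) ≡ inBlock i c p y
    at i c y = trans (lookup∘tabulate _ (fromℕ< p<v)) (cong (λ x → inBlock i c x y) (toℕ-fromℕ< p<v))

  disjoint : ∀ {i i'} → (∀ {c y c' y'} → c < S → y < M → c' < S → y' < M → differ i i' c y c' y' ≡ true) →
             DisjointColl (collection i) (collection i')
  disjoint {i} {i'} ok B B∈ B∈' with ∈-grid⁻ S M (block i) B∈ | ∈-grid⁻ S M (block i') B∈'
  ... | c , y , c<S , y<M , refl | c' , y' , c'<S , y'<M , B≡B' = differ-sound (ok c<S y<M c'<S y'<M) B≡B'

  distinct : distinctOK ≡ true → ∀ {c y c' y'} → c < S → y < M → c' < S → y' < M →
             differ 0 1 c y c' y' ≡ true × differ 0 2 c y c' y' ≡ true × differ 1 2 c y c' y' ≡ true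
  distinct ok {c} {y} {c'} {y'} c<S y<M c'<S y'<M
    with ∧-true {differ 0 1 c y c' y'} (allBelow-sound (allBelow-sound (allBelow-sound (allBelow-sound ok c<S) y<M) c'<S) y'<M)
  ... | d₀₁ , rest = d₀₁ , ∧-true rest

  pairTrade : ∀ {k} → sizesOK k ≡ true → pairsOK ≡ true → distinctOK ≡ true → PairTrade v k (S * M)
  pairTrade sizesOk pairsOk distinctOk = record
    { T₁ = collection 0 ; T₂ = collection 1 ; T₃ = collection 2
    ; vol₁ = volume 0 ; vol₂ = volume 1 ; vol₃ = volume 2
    ; blocks₁ = sizes sizesOk (s≤s z≤n) ; blocks₂ = sizes sizesOk (s≤s (s≤s z≤n))
    ; blocks₃ = sizes sizesOk (s≤s (s≤s (s≤s z≤n)))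
    ; disj₁₂ = disjoint λ c<S y<M c'<S y'<M → proj₁ (distinct distinctOk c<S y<M c'<S y'<M)
    ; disj₁₃ = disjoint λ c<S y<M c'<S y'<M → proj₁ (proj₂ (distinct distinctOk c<S y<M c'<S y'<M))
    ; disj₂₃ = disjoint λ c<S y<M c'<S y'<M → proj₂ (proj₂ (distinct distinctOk c<S y<M c'<S y'<M))
    ; pairs₁₂ = λ p q p≢q → proj₁ (agree-all pairsOk p q p≢q)
    ; pairs₁₃ = λ p q p≢q → proj₁ (proj₂ (agree-all pairsOk p q p≢q))
    ; steiner = λ p q p≢q → proj₂ (proj₂ (agree-all pairsOk p q p≢q)) }

-- the k-th entry of a list (0 beyond its end)
entry : List ℕ → ℕ → ℕ
entry []       k       = 0
entry (x ∷ xs) zero    = x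
entry (x ∷ xs) (suc k) = entry xs k

-- GF(8) = F₂[x]/(x³ + x + 1), elements written as 3-bit numbers
gf8-add : ℕ → ℕ → ℕ
gf8-add a b = (a % 2 + b % 2) % 2 + 2 * ((a / 2 % 2 + b / 2 % 2) % 2) + 4 * ((a / 4 % 2 + b / 4 % 2) % 2)

gf8-mul : ℕ → ℕ → ℕ
gf8-mul a b = entry gf8-table (8 * a + b)
  where
  gf8-table : List ℕ
  gf8-table = 0 ∷ 0 ∷ 0 ∷ 0 ∷ 0 ∷ 0 ∷ 0 ∷ 0 ∷ 0 ∷ 1 ∷ 2 ∷ 3 ∷ 4 ∷ 5 ∷ 6 ∷ 7 ∷
              0 ∷ 2 ∷ 4 ∷ 6 ∷ 3 ∷ 1 ∷ 7 ∷ 5 ∷ 0 ∷ 3 ∷ 6 ∷ 5 ∷ 7 ∷ 4 ∷ 1 ∷ 2 ∷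
              0 ∷ 4 ∷ 3 ∷ 7 ∷ 6 ∷ 2 ∷ 5 ∷ 1 ∷ 0 ∷ 5 ∷ 1 ∷ 4 ∷ 2 ∷ 7 ∷ 3 ∷ 6 ∷
              0 ∷ 6 ∷ 7 ∷ 1 ∷ 5 ∷ 3 ∷ 2 ∷ 4 ∷ 0 ∷ 7 ∷ 5 ∷ 2 ∷ 1 ∷ 6 ∷ 4 ∷ 3 ∷ []

-- the parallel classes of lines x + c·y = const (c < s) of the affine plane
-- AG(2,8), whose points (x , y) are coded as 8y + x
affineLines : ℕ → ParallelClasses
affineLines s = record
  { points = 64 ; classes = s ; colours = 8
  ; colour = λ c p → gf8-add (p % 8) (gf8-mul c (p / 8)) }

groupShift : List ℕ → ℕ → ℕ → ℕ
groupShift d zero          j = 0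
groupShift d (suc zero)    j = j
groupShift d (suc (suc c)) j = entry d j

-- three parallel classes on ℤ_M × {0,…,7} (point (x , j) coded as jM + x):
-- class c joins the points (x , j) with equal x + shift_c(j) mod M
shiftedClasses : (M : ℕ) .{{_ : NonZero M}} → List ℕ → ParallelClasses
shiftedClasses M d = record
  { points = 8 * M ; classes = 3 ; colours = M
  ; colour = λ c p → (p % M + groupShift d c (p / M)) % M }

Realisable : ℕ → Set
Realisable m = ∃[ v ] PairTrade v 9 m

realisable-+ : ∀ {a b} → Realisable a → Realisable b → Realisable (a + b)
realisable-+ (v , G) (w , H) = v + w , DisjointUnion.union G H

realisable24 : Realisable 24
realisable24 = _ , CyclicExtension.pairTrade (affineLines 3) refl refl refl

realisable32 : Realisable 32
realisable32 = _ , CyclicExtension.pairTrade (affineLines 4) refl refl refl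

realisable40 : Realisable 40
realisable40 = _ , CyclicExtension.pairTrade (affineLines 5) refl refl refl

realisable-3* : ∀ t → Realisable (3 * (8 + t))
realisable-3* 0 = realisable24
realisable-3* 1 = _ , CyclicExtension.pairTrade (shiftedClasses 9  (0 ∷ 2 ∷ 4 ∷ 6 ∷ 8 ∷ 1 ∷ 3 ∷ 5 ∷ [])) refl refl refl
realisable-3* 2 = _ , CyclicExtension.pairTrade (shiftedClasses 10 (0 ∷ 2 ∷ 1 ∷ 5 ∷ 7 ∷ 9 ∷ 4 ∷ 3 ∷ [])) refl refl refl
realisable-3* 3 = _ , CyclicExtension.pairTrade (shiftedClasses 11 (0 ∷ 2 ∷ 4 ∷ 6 ∷ 8 ∷ 10 ∷ 1 ∷ 3 ∷ [])) refl refl refl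
realisable-3* 4 = _ , CyclicExtension.pairTrade (shiftedClasses 12 (0 ∷ 2 ∷ 1 ∷ 5 ∷ 7 ∷ 3 ∷ 10 ∷ 4 ∷ [])) refl refl refl
realisable-3* 5 = _ , CyclicExtension.pairTrade (shiftedClasses 13 (0 ∷ 2 ∷ 4 ∷ 6 ∷ 8 ∷ 10 ∷ 12 ∷ 1 ∷ [])) refl refl refl
realisable-3* 6 = _ , CyclicExtension.pairTrade (shiftedClasses 14 (0 ∷ 2 ∷ 1 ∷ 5 ∷ 7 ∷ 3 ∷ 10 ∷ 4 ∷ [])) refl refl refl
realisable-3* 7 = _ , CyclicExtension.pairTrade (shiftedClasses 15 (0 ∷ 2 ∷ 4 ∷ 6 ∷ 8 ∷ 10 ∷ 12 ∷ 14 ∷ [])) refl refl refl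
realisable-3* (suc (suc (suc (suc (suc (suc (suc (suc t)))))))) =
  subst Realisable (add24 t) (realisable-+ realisable24 (realisable-3* t))
  where
  add24 : ∀ t → 24 + 3 * (8 + t) ≡ 3 * (8 + (8 + t))
  add24 = solve-∀

data Residue3 : ℕ → Set where
  rem0 : ∀ q → Residue3 (3 * q)
  rem1 : ∀ q → Residue3 (1 + 3 * q)
  rem2 : ∀ q → Residue3 (2 + 3 * q)

residue3 : ∀ m → Residue3 m
residue3 zero = rem0 0
residue3 (suc m) with residue3 m
... | rem0 q = rem1 q
... | rem1 q = rem2 q
... | rem2 q = subst Residue3 (next q) (rem0 (suc q))
  where
  next : ∀ q → 3 * suc q ≡ suc (2 + 3 * q)
  next = solve-∀

admissible-bound : ∀ n (f : ℕ → ℕ) → allBelow n (λ q → (f q <ᵇ 24) ∨ does (f q ∈? excluded)) ≡ true →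
                   ∀ q → 24 ≤ f q → f q ∉ excluded → n ≤ q
admissible-bound n f ok q 24≤fq admissible with q <? n
... | no q≮n = ≮⇒≥ q≮n
... | yes q<n with ∨-true {f q <ᵇ 24} {does (f q ∈? excluded)} (allBelow-sound ok q<n)
...   | inj₁ small    = ⊥-elim (<⇒≱ (<ᵇ⇒< (f q) 24 (toT small)) 24≤fq)
...   | inj₂ listed   = ⊥-elim (admissible (does-sound (f q ∈? excluded) listed))

-- the shape of the admissible volumes in each residue class (opaque, so that
-- matching on the witnesses does not unfold the proofs of the bounds)
opaque
  multiple-of-3 : ∀ q → 24 ≤ 3 * q → ∃[ t ] 8 + t ≡ q
  multiple-of-3 q 24≤3q = m≤n⇒∃[o]m+o≡n (*-cancelˡ-≤ {8} {q} 3 24≤3q)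

  admissible-1mod3 : ∀ q → 24 ≤ 1 + 3 * q → 1 + 3 * q ∉ excluded → ∃[ t ] 21 + t ≡ q
  admissible-1mod3 q 24≤m admissible = m≤n⇒∃[o]m+o≡n (admissible-bound 21 (λ q → 1 + 3 * q) refl q 24≤m admissible)

  admissible-2mod3 : ∀ q → 24 ≤ 2 + 3 * q → 2 + 3 * q ∉ excluded → ∃[ t ] 18 + t ≡ q
  admissible-2mod3 q 24≤m admissible = m≤n⇒∃[o]m+o≡n (admissible-bound 18 (λ q → 2 + 3 * q) refl q 24≤m admissible)

realisable : ∀ m → 24 ≤ m → m ∉ excluded → Realisable m
realisable m 24≤m admissible with residue3 m
... | rem0 q with multiple-of-3 q 24≤m
...   | t , refl = realisable-3* t
realisable m 24≤m admissible | rem1 q with admissible-1mod3 q 24≤m admissible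
...   | t , refl = subst Realisable (add40 t) (realisable-+ realisable40 (realisable-3* t))
  where
  add40 : ∀ t → 40 + 3 * (8 + t) ≡ 1 + 3 * (21 + t)
  add40 = solve-∀
realisable m 24≤m admissible | rem2 q with admissible-2mod3 q 24≤m admissible
...   | t , refl = subst Realisable (add32 t) (realisable-+ realisable32 (realisable-3* t))
  where
  add32 : ∀ t → 32 + 3 * (8 + t) ≡ 2 + 3 * (18 + t)
  add32 = solve-∀

mainTheorem13 : ∀ (m : ℕ) → 24 ≤ m → m ∉ excluded →
    ∃[ v ] Σ (ThreeWayTrade v 9 2 m) IsSteiner
mainTheorem13 m 24≤m admissible with realisable m 24≤m admissible
... | v , trade = v , pairTrade⇒steinerTrade trade
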